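{- Let $k\ge 2$, $l\ge 1$, and let $\mathcal{F}=(V,\mathcal{E})$ be a $k$-uniform hypergraph on $n=|V|$ vertices which is both an edge-minimal hypertree and an $l$-hypertree. Then $|\mathcal{E}|\le l\,\frac{n(n-1)}{2}$.
   Context: A $k$-uniform hypergraph $\mathcal{H}=(V,\mathcal{E})$ consists of a finite vertex set $V$ and a set $\mathcal{E}$ of $k$-element subsets of $V$ (no multiple edges). A $k$-uniform hypergraph is a chain if there is a sequence $v_1,\dots,v_l$ of its vertices in which every vertex appears at least once (possibly more times), $v_1\ne v_l$, and its edge set consists of exactly the $l-k+1$ distinct sets $\{v_i,\dots,v_{i+k-1}\}$, $1\le i\le l-k+1$; it is a semicycle if the same holds with $v_1=v_l$ instead. The length of a chain is its number of edges. $\mathcal{H}$ is chain-connected if every pair of distinct vertices is contained in some subhypergraph that is a chain; semicycle-free if no subhypergraph is a semicycle. A hypertree is a chain-connected, semicycle-free $k$-uniform hypergraph. An $l$-hypertree is a hypertree in which every chain (subhypergraph) has length at most $l$. An edge-minimal hypertree is a hypertree $(V,\mathcal{E})$ such that for every $e\in\mathcal{E}$, $(V,\mathcal{E}\setminus\{e\})$ is not a hypertree. -}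

module Defs where

open import Data.Nat using (ℕ; zero; suc; _≤_; _≤?_)
open import Data.Fin using (Fin)
open import Data.Fin.Subset using (Subset; ⁅_⁆; _∪_; ⊥; ∣_∣)
open import Data.List using (List; []; _∷_; length; take; map; head; last)
open import Data.List.Relation.Unary.All using (All)
open import Data.List.Relation.Unary.Unique.Propositional using (Unique)
open import Data.List.Membership.Propositional using (_∈_)
open import Data.Maybe using (Maybe)
open import Data.Product using (Σ; _×_; ∃)
open import Relation.Binary.PropositionalEquality using (_≡_; _≢_)
open import Relation.Nullary using (¬_; yes; no)

windows : ∀ {A : Set} → ℕ → List A → List (List A)
windows k [] = []
windows k (x ∷ xs) with k ≤? length (x ∷ xs)
... | yes _ = take k (x ∷ xs) ∷ windows k xs
... | no _ = []

toSet : ∀ {n} → List (Fin n) → Subset n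
toSet [] = ⊥
toSet (x ∷ xs) = ⁅ x ⁆ ∪ toSet xs

record Hypergraph (k n : ℕ) : Set where
  field
    edges   : List (Subset n)
    uniform : All (λ e → ∣ e ∣ ≡ k) edges
    simple  : Unique edges

-- Edge sets are described by a membership predicate (so that edge removal is easy).
EdgePred : ℕ → Set₁
EdgePred n = Subset n → Set

-- The sequence s induces a subhypergraph whose edges are the l-k+1 windows
-- {v_i,...,v_{i+k-1}}: each window consists of k distinct vertices,
-- the windows are pairwise distinct sets, and each is an edge of the hypergraph.
-- Its vertex set is the set of vertices occurring in s.
IsSeq : ∀ {n} → ℕ → EdgePred n → List (Fin n) → Set
IsSeq k E s =
  k ≤ length s
  × All Unique (windows k s)
  × Unique (map toSet (windows k s))
  × All (λ w → E (toSet w)) (windows k s)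

IsChain : ∀ {n} → ℕ → EdgePred n → List (Fin n) → Set
IsChain k E s = IsSeq k E s × head s ≢ last s

IsSemicycle : ∀ {n} → ℕ → EdgePred n → List (Fin n) → Set
IsSemicycle k E s = IsSeq k E s × head s ≡ last s

chainLength : ∀ {n} → ℕ → List (Fin n) → ℕ
chainLength k s = length (windows k s)

ChainConnected : ∀ {n} → ℕ → EdgePred n → Set
ChainConnected {n} k E =
  (u v : Fin n) → u ≢ v →
  ∃ λ s → IsChain k E s × u ∈ s × v ∈ s

SemicycleFree : ∀ {n} → ℕ → EdgePred n → Set
SemicycleFree {n} k E = (s : List (Fin n)) → ¬ IsSemicycle k E s

IsHypertree : ∀ {n} → ℕ → EdgePred n → Set
IsHypertree k E = ChainConnected k E × SemicycleFree k E

IsLHypertree : ∀ {n} → ℕ → ℕ → EdgePred n → Set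
IsLHypertree {n} k l E =
  IsHypertree k E ×
  ((s : List (Fin n)) → IsChain k E s → chainLength k s ≤ l)

removeEdge : ∀ {n} → EdgePred n → Subset n → EdgePred n
removeEdge E e f = E f × f ≢ e

IsEdgeMinimalHypertree : ∀ {n} → ℕ → EdgePred n → Set
IsEdgeMinimalHypertree {n} k E =
  IsHypertree k E × ((e : Subset n) → E e → ¬ IsHypertree k (removeEdge E e))

edgeOf : ∀ {k n} → Hypergraph k n → EdgePred n
edgeOf H e = e ∈ Hypergraph.edges H

module Submission where

-- Chain-connectedness provides, for every pair of distinct
-- vertices u, v, a chain containing both; keep one such chain for each of the
-- n(n-1)/2 unordered pairs and let S be the list of all their edges.  Since F
-- is an l-hypertree, each kept chain has at most l edges, so
-- |S| ≤ l · n(n-1)/2.  On the other hand every edge e of F occurs in S: if it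
-- did not, the kept chains would still connect every pair after deleting e,
-- and deleting an edge never creates a semicycle, so F minus e would again be
-- a hypertree, contradicting edge-minimality.  As the edges of F are pairwise
-- distinct, |E| ≤ |S|.

open import Defs
open import Data.Nat using (ℕ; zero; suc; _≤_; _<_; _*_; _∸_; _+_; z≤n; s≤s)
open import Data.Nat.Properties
  using (+-mono-≤; *-monoʳ-≤; *-suc; *-commutativeSemigroup; *-distribˡ-+; <-cmp; module ≤-Reasoning)
open import Data.Nat.Solver using (module +-*-Solver)
open import Algebra.Properties.CommutativeSemigroup *-commutativeSemigroup using (x∙yz≈y∙xz)
open import Data.List using (List; []; _∷_; _++_; length; map; concatMap; allFin)
open import Data.List.Properties using (length-++; length-++-sucʳ; length-map; length-tabulate)
import Data.List.Relation.Unary.All as All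
open import Data.List.Relation.Unary.Any as Any using (here; there)
open import Data.List.Relation.Unary.AllPairs using (_∷_)
open import Data.List.Relation.Unary.Unique.Propositional using (Unique)
open import Data.List.Relation.Binary.Subset.Propositional using (_⊆_)
open import Data.List.Membership.Propositional using (_∈_)
open import Data.List.Membership.Propositional.Properties
  using (∈-∃++; ∈-map⁺; ∈-allFin; ∈-++⁺ˡ; ∈-++⁺ʳ; ∈-concatMap⁺)
import Data.List.Membership.DecPropositional as DecMembership
open import Data.Fin using (Fin; toℕ; _≟_)
open import Data.Fin.Properties using (toℕ-injective)
open import Data.Fin.Subset using (Subset)
open import Data.Vec.Properties using (≡-dec)
import Data.Bool.Properties as Bool
open import Data.Product using (∃; _×_; _,_; proj₁)
open import Data.Sum using (_⊎_; inj₁; inj₂)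
open import Data.Empty using (⊥-elim)
open import Function using (id)
open import Relation.Binary.Definitions using (tri<; tri≈; tri>)
open import Relation.Binary.PropositionalEquality using (_≡_; _≢_; refl; sym; cong; cong₂; subst; module ≡-Reasoning)
open import Relation.Nullary using (¬_; yes; no)

module _ {A : Set} where

  ∈-delete : ∀ {x y : A} as {bs} → y ∈ as ++ x ∷ bs → y ≢ x → y ∈ as ++ bs
  ∈-delete []       (here y≡x)  y≢x = ⊥-elim (y≢x y≡x)
  ∈-delete []       (there y∈)  _   = y∈
  ∈-delete (a ∷ as) (here y≡a)  _   = here y≡a
  ∈-delete (a ∷ as) (there y∈)  y≢x = there (∈-delete as y∈ y≢x)

  unique-⊆⇒length-≤ : {xs ys : List A} → Unique xs → xs ⊆ ys → length xs ≤ length ys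
  unique-⊆⇒length-≤ {[]}     _                  _      = z≤n
  unique-⊆⇒length-≤ {x ∷ xs} (x∉xs ∷ unique-xs) xs⊆ys
    with as , bs , refl ← ∈-∃++ (xs⊆ys (here refl)) =
    subst (_ ≤_) (sym (length-++-sucʳ as x bs)) (s≤s (unique-⊆⇒length-≤ unique-xs shrink))
    where
    shrink : xs ⊆ as ++ bs
    shrink {y} y∈xs = ∈-delete as (xs⊆ys (there y∈xs)) (λ y≡x → All.lookup x∉xs y∈xs (sym y≡x))

length-concatMap-≤ : ∀ {A B : Set} (l : ℕ) (f : A → List B) →
  (∀ x → length (f x) ≤ l) → ∀ xs → length (concatMap f xs) ≤ l * length xs
length-concatMap-≤ l f bounded []       = z≤n
length-concatMap-≤ l f bounded (x ∷ xs) = begin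
  length (f x ++ concatMap f xs)           ≡⟨ length-++ (f x) ⟩
  length (f x) + length (concatMap f xs)   ≤⟨ +-mono-≤ (bounded x) (length-concatMap-≤ l f bounded xs) ⟩
  l + l * length xs                        ≡⟨ sym (*-suc l (length xs)) ⟩
  l * suc (length xs)                      ∎
  where open ≤-Reasoning

-- The unordered pairs of Fin n, each listed once as (u , v) with u < v.
pairs : (n : ℕ) → List (Fin n × Fin n)
pairs zero    = []
pairs (suc n) = map (λ v → (Fin.zero , Fin.suc v)) (allFin n)
             ++ map (λ { (u , v) → (Fin.suc u , Fin.suc v) }) (pairs n)

∈-pairs : ∀ {n} (u v : Fin n) → toℕ u < toℕ v → (u , v) ∈ pairs n
∈-pairs {suc n} Fin.zero    (Fin.suc v) _         = ∈-++⁺ˡ (∈-map⁺ _ (∈-allFin v))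
∈-pairs {suc n} (Fin.suc u) (Fin.suc v) (s≤s u<v) = ∈-++⁺ʳ _ (∈-map⁺ _ (∈-pairs u v u<v))

CoversPairs : ∀ {n} → List (Fin n × Fin n) → Set
CoversPairs {n} ps = (u v : Fin n) → u ≢ v → (u , v) ∈ ps ⊎ (v , u) ∈ ps

pairs-cover : ∀ {n} → CoversPairs (pairs n)
pairs-cover u v u≢v with <-cmp (toℕ u) (toℕ v)
... | tri< u<v _ _ = inj₁ (∈-pairs u v u<v)
... | tri≈ _ u≡v _ = ⊥-elim (u≢v (toℕ-injective u≡v))
... | tri> _ _ v<u = inj₂ (∈-pairs v u v<u)

length-pairs : ∀ n → 2 * length (pairs n) ≡ n * (n ∸ 1)
length-pairs zero          = refl
length-pairs (suc zero)    = refl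
length-pairs (suc (suc m)) = begin
  2 * length (pairs (suc (suc m)))                ≡⟨ cong (2 *_) length-split ⟩
  2 * (suc m + length (pairs (suc m)))            ≡⟨ *-distribˡ-+ 2 (suc m) _ ⟩
  2 * suc m + 2 * length (pairs (suc m))          ≡⟨ cong (2 * suc m +_) (length-pairs (suc m)) ⟩
  2 * suc m + suc m * m                           ≡⟨ triangle m ⟩
  suc (suc m) * suc m                             ∎
  where
  open ≡-Reasoning
  open +-*-Solver
  length-split : length (pairs (suc (suc m))) ≡ suc m + length (pairs (suc m))
  length-split = begin
    length (pairs (suc (suc m)))                                   ≡⟨ length-++ (map _ (allFin (suc m))) ⟩
    length (map _ (allFin (suc m))) + length (map _ (pairs (suc m))) ≡⟨ cong₂ _+_ (length-map _ (allFin (suc m))) (length-map _ (pairs (suc m))) ⟩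
    length (allFin (suc m)) + length (pairs (suc m))               ≡⟨ cong (_+ length (pairs (suc m))) (length-tabulate id) ⟩
    suc m + length (pairs (suc m))                                 ∎
  triangle : ∀ m → 2 * suc m + suc m * m ≡ suc (suc m) * suc m
  triangle = solve 1 (λ m → con 2 :* (con 1 :+ m) :+ (con 1 :+ m) :* m := (con 2 :+ m) :* (con 1 :+ m)) refl

chainEdges : ∀ {n} → ℕ → List (Fin n) → List (Subset n)
chainEdges k s = map toSet (windows k s)

seq-restrict : ∀ {k n} (E E′ : EdgePred n) (s : List (Fin n)) →
  IsSeq k E s → (∀ {w} → w ∈ windows k s → E (toSet w) → E′ (toSet w)) → IsSeq k E′ s
seq-restrict _ _ _ (long , windows-unique , edges-distinct , in-E) E⇒E′ =
  long , windows-unique , edges-distinct , All.tabulate (λ w∈ → E⇒E′ w∈ (All.lookup in-E w∈))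

semicycleFree-removeEdge : ∀ {k n} (E : EdgePred n) (e : Subset n) →
  SemicycleFree k E → SemicycleFree k (removeEdge E e)
semicycleFree-removeEdge E e sf s (seq , closed) =
  sf s (seq-restrict (removeEdge E e) E s seq (λ _ → proj₁) , closed)

-- For a list
-- ps of vertex pairs, usedEdges ps (the list S of the proof) collects the
-- edges of the chains connecting the pairs in ps.
module ChosenChains {k n : ℕ} (E : EdgePred n) (connect : ChainConnected k E) where

  pairEdges : Fin n × Fin n → List (Subset n)
  pairEdges (u , v) with u ≟ v
  ... | yes _   = []
  ... | no u≢v  = chainEdges k (proj₁ (connect u v u≢v))

  usedEdges : List (Fin n × Fin n) → List (Subset n)
  usedEdges = concatMap pairEdges

  length-usedEdges : ∀ l → (∀ s → IsChain k E s → chainLength k s ≤ l) →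
    ∀ ps → length (usedEdges ps) ≤ l * length ps
  length-usedEdges l short = length-concatMap-≤ l pairEdges pairEdges-short
    where
    pairEdges-short : ∀ p → length (pairEdges p) ≤ l
    pairEdges-short (u , v) with u ≟ v
    ... | yes _  = z≤n
    ... | no u≢v with s , chain , _ ← connect u v u≢v =
      subst (_≤ l) (sym (length-map toSet (windows k s))) (short s chain)

  pairChain : ∀ u v → u ≢ v →
    ∃ λ s → IsChain k E s × u ∈ s × v ∈ s × chainEdges k s ⊆ pairEdges (u , v)
  pairChain u v u≢v with u ≟ v
  ... | yes u≡v  = ⊥-elim (u≢v u≡v)
  ... | no u≢v′ with s , chain , u∈s , v∈s ← connect u v u≢v′ = s , chain , u∈s , v∈s , id

  connectedWithin : (ps : List (Fin n × Fin n)) → CoversPairs ps → ∀ u v → u ≢ v →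
    ∃ λ s → IsChain k E s × u ∈ s × v ∈ s × chainEdges k s ⊆ usedEdges ps
  connectedWithin ps covers u v u≢v with covers u v u≢v
  ... | inj₁ uv∈ps with s , chain , u∈s , v∈s , ⊆pair ← pairChain u v u≢v =
    s , chain , u∈s , v∈s , λ e∈ → ∈-concatMap⁺ pairEdges (Any.map (λ { refl → ⊆pair e∈ }) uv∈ps)
  ... | inj₂ vu∈ps with s , chain , v∈s , u∈s , ⊆pair ← pairChain v u (λ v≡u → u≢v (sym v≡u)) =
    s , chain , u∈s , v∈s , λ e∈ → ∈-concatMap⁺ pairEdges (Any.map (λ { refl → ⊆pair e∈ }) vu∈ps)

  connected-removeEdge : (ps : List (Fin n × Fin n)) → CoversPairs ps →
    ∀ e → ¬ e ∈ usedEdges ps → ChainConnected k (removeEdge E e)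
  connected-removeEdge ps covers e e∉S u v u≢v
    with s , (seq , open′) , u∈s , v∈s , ⊆S ← connectedWithin ps covers u v u≢v =
    s , (seq-restrict E (removeEdge E e) s seq avoids-e , open′) , u∈s , v∈s
    where
    avoids-e : ∀ {w} → w ∈ windows k s → E (toSet w) → removeEdge E e (toSet w)
    avoids-e w∈ w∈E = w∈E , λ { refl → e∉S (⊆S (∈-map⁺ toSet w∈)) }

  minimal⇒edges-used : (ps : List (Fin n × Fin n)) → CoversPairs ps →
    IsEdgeMinimalHypertree k E → ∀ e → E e → e ∈ usedEdges ps
  minimal⇒edges-used ps covers ((_ , sf) , minimal) e e∈E
    with DecMembership._∈?_ (≡-dec Bool._≟_) e (usedEdges ps)
  ... | yes e∈S = e∈S
  ... | no e∉S  = ⊥-elim (minimal e e∈E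
                    (connected-removeEdge ps covers e e∉S , semicycleFree-removeEdge E e sf))

-- Main theorem: |E| ≤ |S| ≤ l · (number of unordered pairs) = l · n(n-1)/2.
theorem10 : (k l n : ℕ) → 2 ≤ k → 1 ≤ l → (F : Hypergraph k n) →
    IsEdgeMinimalHypertree k (edgeOf F) → IsLHypertree k l (edgeOf F) →
    2 * length (Hypergraph.edges F) ≤ l * (n * (n ∸ 1))
theorem10 k l n _ _ F minimal@((connect , _) , _) (_ , short) = begin
  2 * length (Hypergraph.edges F)     ≤⟨ *-monoʳ-≤ 2 edges≤used ⟩
  2 * length (usedEdges (pairs n))    ≤⟨ *-monoʳ-≤ 2 (length-usedEdges l short (pairs n)) ⟩
  2 * (l * length (pairs n))          ≡⟨ swap-factors ⟩
  l * (2 * length (pairs n))          ≡⟨ cong (l *_) (length-pairs n) ⟩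
  l * (n * (n ∸ 1))                   ∎
  where
  open ChosenChains (edgeOf F) connect
  open ≤-Reasoning
  edges≤used : length (Hypergraph.edges F) ≤ length (usedEdges (pairs n))
  edges≤used = unique-⊆⇒length-≤ (Hypergraph.simple F)
                 (minimal⇒edges-used (pairs n) pairs-cover minimal _)
  swap-factors : 2 * (l * length (pairs n)) ≡ l * (2 * length (pairs n))
  swap-factors = x∙yz≈y∙xz 2 l (length (pairs n))
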